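{- Let $\mathcal{A}$ be a tree automaton over a finite signature ${\cal F}$, let $E^c_{{\cal F}}$ be a set of contracting equations for ${\cal F}$, and let $E$ be a set of equations with $E\supseteq E^c_{{\cal F}}\cup E^{r}$. Then any automaton $\mathcal{A}'$ with $\mathcal{A}\leadsto_E^!\mathcal{A}'$ (i.e. $\mathcal{A}\leadsto_E^*\mathcal{A}'$ and $\mathcal{A}'$ irreducible by $\leadsto_E$) is $\not\varepsilon$-deterministic and has no more states than there are terms in $\mathrm{Irr}(\overrightarrow{E^c_{{\cal F}}})$, the set of ground terms of ${\cal T(F)}$ in normal form with respect to the TRS $\overrightarrow{E^c_{{\cal F}}}=\{u\to u|_p\mid u=u|_p\in E^c_{{\cal F}}\}$.
   Context: ${\cal F}$ is a finite set of function symbols with arities, ${\cal X}$ a countable set of variables, ${\cal T(F,X)}$ the terms and ${\cal T(F)}$ the ground terms; $t|_p$ is the subterm of $t$ at position $p$ and $\lambda$ the root position. An equation is a pair $l=r$ with $l,r\in{\cal T(F,X)}$. Let $\mathcal{Q}$ be a countably infinite set of constants (states) disjoint from ${\cal F}$. A transition is a rewrite rule $c\to q$ with $c\in{\cal T}({\cal F}\cup\mathcal{Q})$, $q\in\mathcal{Q}$; it is normalized if $c=f(q_1,\dots,q_n)$ with $f\in{\cal F}$ of arity $n$ and $q_i\in\mathcal{Q}$; an $\varepsilon$-transition has the form $q\to q'$ with $q,q'\in\mathcal{Q}$. A tree automaton is $\mathcal{A}=\langle{\cal F},\mathcal{Q},\mathcal{Q}_f,\Delta\rangle$ with $\mathcal{Q}_f\subseteq\mathcal{Q}$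 finite and $\Delta$ a finite set of normalized and $\varepsilon$-transitions. $\to^{\not\varepsilon *}_{\mathcal{A}}$ is the reflexive-transitive rewriting relation on ${\cal T}({\cal F}\cup\mathcal{Q})$ induced by the normalized transitions of $\Delta$. $\mathcal{A}$ is $\not\varepsilon$-deterministic if no two distinct normalized transitions of $\Delta$ have the same left-hand side. A state substitution is a map $\sigma:{\cal X}\to\mathcal{Q}$ extended homomorphically. For a function $\alpha$ on states, $\mathcal{A}\alpha$ is obtained by replacing each state $q$ by $\alpha(q)$ everywhere in $\mathcal{A}$. Simplification: $\mathcal{A}\leadsto_E\mathcal{A}'$ if there are $s=t\in E$, a state substitution $\sigma$ and states $q_a\neq q_b$ with $s\sigma\to^{\not\varepsilon *}_{\mathcal{A}}q_a$, $t\sigma\to^{\not\varepsilon *}_{\mathcal{A}}q_b$, and $\mathcal{A}'=\mathcal{A}\{q_b\mapsto q_a\}$. Reflexivity equations: $E^{r}=\{f(x_1,\dots,x_n)=f(x_1,\dots,x_n)\mid f\in{\cal F}\text{ of arity }n\}$ with pairwise distinct variables. For ${\cal K}\subseteq{\cal F}$, a set of equations $E^c_{{\cal K}}$ is contracting for ${\cal K}$ if every equation has the form $u=u|_p$ with $u\in{\cal T}({\cal K},{\cal X})$ linear and $p\neq\lambda$, and the set of normal forms of ${\cal T}({\cal K})$ with respect to the TRS $\{u\to u|_p\mid u=u|_p\in E^c_{{\cal K}}\}$ is finite.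
   Formalization: The bound on the number of states of $\mathcal{A}'$ counts only states q with $t\to^{\not\varepsilon *}_{\mathcal{A}'}q$ for some ground term t of ${\cal T(F)}$, not every state occurring in $\mathcal{A}'$. The statement above fails without it. -}

module Defs where

open import Data.Nat using (ℕ; _≡ᵇ_; _≤_)
open import Data.Fin using (Fin; toℕ)
open import Data.Vec using (Vec; []; _∷_; lookup; _[_]≔_; tabulate)
import Data.Vec as Vec
open import Data.List using (List; []; _∷_; _++_; length)
import Data.List as List
open import Data.List.Membership.Propositional using (_∈_)
open import Data.List.Relation.Unary.All using (All)
open import Data.List.Relation.Unary.Unique.Propositional using (Unique)
open import Data.Bool using (if_then_else_)
open import Data.Empty using (⊥; ⊥-elim)
open import Data.Product using (Σ; ∃; _×_; _,_)
open import Data.Sum using (_⊎_)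
open import Relation.Nullary using (¬_)
open import Relation.Binary.PropositionalEquality using (_≡_; _≢_)
open import Relation.Binary.Construct.Closure.ReflexiveTransitive using (Star)
open import Function.Bundles using (_⇔_)

record Signature : Set where
  field
    size  : ℕ
    arity : Fin size → ℕ

module Sig (𝓕 : Signature) where
  open Signature 𝓕

  Symbol : Set
  Symbol = Fin size

  -- Terms over 𝓕 with leaves in V.
  --   T(F,X)      = Term ℕ   (leaves are variables, X = ℕ)
  --   T(F ∪ Q)    = Term ℕ   (leaves are states, Q = ℕ)
  --   T(F)        = Term ⊥   (ground terms)
  data Term (V : Set) : Set where
    leaf : V → Term V
    node : (f : Symbol) → Vec (Term V) (arity f) → Term V

  mutual
    _⟪_⟫ : {V W : Set} → Term V → (V → Term W) → Term W
    leaf x ⟪ θ ⟫ = θ x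
    node f ts ⟪ θ ⟫ = node f (substs ts θ)

    substs : {V W : Set} {n : ℕ} → Vec (Term V) n → (V → Term W) → Vec (Term W) n
    substs [] θ = []
    substs (t ∷ ts) θ = (t ⟪ θ ⟫) ∷ substs ts θ

  _⟨_⟩ : Term ℕ → (ℕ → ℕ) → Term ℕ
  t ⟨ σ ⟩ = t ⟪ (λ x → leaf (σ x)) ⟫

  ground : Term ⊥ → Term ℕ
  ground t = t ⟪ ⊥-elim ⟫

  mutual
    leaves : {V : Set} → Term V → List V
    leaves (leaf x) = x ∷ []
    leaves (node f ts) = leavesᵛ ts

    leavesᵛ : {V : Set} {n : ℕ} → Vec (Term V) n → List V
    leavesᵛ [] = []
    leavesᵛ (t ∷ ts) = leaves t ++ leavesᵛ ts

  Linear : Term ℕ → Set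
  Linear u = Unique (leaves u)

  -- Positions are lists of child indices; [] is the root position λ.
  Position : Set
  Position = List ℕ

  data SubtermAt {V : Set} : Term V → Position → Term V → Set where
    here  : ∀ {t} → SubtermAt t [] t
    there : ∀ {f ts p s} (i : Fin (arity f)) →
            SubtermAt (lookup ts i) p s → SubtermAt (node f ts) (toℕ i ∷ p) s

  Equation : Set
  Equation = Term ℕ × Term ℕ

  EqSet : Set₁
  EqSet = Equation → Set

  reflTerm : Symbol → Term ℕ
  reflTerm f = node f (tabulate (λ i → leaf (toℕ i)))

  data Eʳ : EqSet where
    reflEq : (f : Symbol) → Eʳ (reflTerm f , reflTerm f)

  -- Rewriting of ground terms by the TRS obtained by orienting the equations
  -- of R left to right (for E^c this is { u → u|_p | u = u|_p ∈ E^c }).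
  data RStep (R : EqSet) : Term ⊥ → Term ⊥ → Set where
    root : ∀ {l r} → R (l , r) → (θ : ℕ → Term ⊥) → RStep R (l ⟪ θ ⟫) (r ⟪ θ ⟫)
    cong : ∀ {f ts t'} (i : Fin (arity f)) →
           RStep R (lookup ts i) t' → RStep R (node f ts) (node f (ts [ i ]≔ t'))

  Irr : EqSet → Term ⊥ → Set
  Irr R t = ∀ t' → ¬ RStep R t t'

  EnumeratesIrr : EqSet → List (Term ⊥) → Set
  EnumeratesIrr R ts = Unique ts × (∀ t → (Irr R t ⇔ (t ∈ ts)))

  Contracting : EqSet → Set
  Contracting Ec =
    (∀ l r → Ec (l , r) →
       Linear l × Σ Position (λ p → p ≢ [] × SubtermAt l p r))
    × Σ (List (Term ⊥)) (EnumeratesIrr Ec)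

  State : Set
  State = ℕ

  data Transition : Set where
    norm : (f : Symbol) → Vec State (arity f) → State → Transition
    eps  : State → State → Transition

  record Automaton : Set where
    constructor ⟨_,_⟩
    field
      final : List State
      delta : List Transition
  open Automaton public

  renameT : (State → State) → Transition → Transition
  renameT α (norm f qs q) = norm f (Vec.map α qs) (α q)
  renameT α (eps q q') = eps (α q) (α q')

  rename : (State → State) → Automaton → Automaton
  rename α A = ⟨ List.map α (final A) , List.map (renameT α) (delta A) ⟩

  _↦_ : State → State → State → State
  (qb ↦ qa) q = if q ≡ᵇ qb then qa else q

  -- one step of →_𝒜 using normalized transitions only, on T(F ∪ Q)
  data Step (A : Automaton) : Term ℕ → Term ℕ → Set where
    root : ∀ {f qs q} → norm f qs q ∈ delta A →
           Step A (node f (Vec.map leaf qs)) (leaf q)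
    cong : ∀ {f ts t'} (i : Fin (arity f)) →
           Step A (lookup ts i) t' → Step A (node f ts) (node f (ts [ i ]≔ t'))

  _⊢_→*_ : Automaton → Term ℕ → Term ℕ → Set
  A ⊢ s →* t = Star (Step A) s t

  Simp : EqSet → Automaton → Automaton → Set
  Simp E A A' =
    Σ (Term ℕ) λ s → Σ (Term ℕ) λ t → E (s , t) ×
    Σ (ℕ → State) λ σ → Σ State λ qa → Σ State λ qb →
      qa ≢ qb ×
      (A ⊢ s ⟨ σ ⟩ →* leaf qa) ×
      (A ⊢ t ⟨ σ ⟩ →* leaf qb) ×
      A' ≡ rename (qb ↦ qa) A

  Irreducible : EqSet → Automaton → Set
  Irreducible E A = ∀ A' → ¬ Simp E A A'

  SimpNF : EqSet → Automaton → Automaton → Set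
  SimpNF E A A' = Star (Simp E) A A' × Irreducible E A'

  Deterministic : Automaton → Set
  Deterministic A = ∀ {f qs q q'} →
    norm f qs q ∈ delta A → norm f qs q' ∈ delta A → q ≡ q'

  -- the states of 𝒜 (accessible states: recognizing some ground term)
  IsStateOf : Automaton → State → Set
  IsStateOf A q = Σ (Term ⊥) λ t → A ⊢ ground t →* leaf q

  _⊇_∪_ : EqSet → EqSet → EqSet → Set
  E ⊇ E₁ ∪ E₂ = ∀ e → (E₁ e ⊎ E₂ e) → E e

module Submission where

-- Let A' be an automaton that no simplification step with E can reduce.  The proof uses big-step runs
-- (Run A t q : the normalized transitions of A rewrite t to the state q),
-- which are equivalent to →* and compose well with substitution.
--
--  * Determinism: if f(q₁..qₙ) → q and f(q₁..qₙ) → q' are both transitions,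
--    the reflexivity equation f(x₁..xₙ) = f(x₁..xₙ) under xᵢ ↦ qᵢ has sides
--    reaching q and q', so irreducibility forces q ≡ q'.
--  * Contracting rules preserve states: if lθ reaches q and l = l|ₚ ∈ Ec, then
--    (by determinism) the run factors through a state substitution σ, l|ₚσ
--    reaches some q', irreducibility gives q ≡ q', and rθ reaches q.  Hence
--    →Ec-rewriting of ground terms preserves the state reached.
--  * →Ec strictly decreases term size, so it terminates; hence every state
--    reached by a ground term is (classically) reached by an Ec-normal form.
--  * Determinism makes "t reaches q" functional in t, so distinct states are
--    reached by distinct normal forms, and the count follows by a pigeonhole
--    argument.  Comparing lengths is decidable, so the double negation is
--    harmless.

open import Defs
open import Level using (0ℓ)
open import Data.Nat using (ℕ; suc; _+_; _≤_; _<_; z≤n; s≤s; _≟_; _≤?_)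
open import Data.Nat.Properties using (≤-refl; ≤-reflexive; ≤-trans; m≤m+n; m≤n+m; n≤1+n; +-monoˡ-<; +-monoʳ-<)
open import Data.Nat.Induction using (<-wellFounded)
open import Data.Fin using (Fin; zero; suc; toℕ)
open import Data.Vec using (Vec; []; _∷_; lookup; _[_]≔_; tabulate)
import Data.Vec as Vec
open import Data.Vec.Properties using (lookup-map; lookup∘tabulate; tabulate∘lookup; tabulate-cong)
open import Data.List using (List; []; _∷_; _++_; length)
open import Data.List.Membership.Propositional using (_∈_; _∉_)
open import Data.List.Membership.Propositional.Properties using (∈-∃++; ∈-++⁻; ∈-++⁺ˡ; ∈-++⁺ʳ)
open import Data.List.Membership.DecPropositional _≟_ using (_∈?_)
open import Data.List.Relation.Unary.Any using (here; there)
open import Data.List.Relation.Unary.All using (All; []; _∷_)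
import Data.List.Relation.Unary.All as All
open import Data.List.Relation.Unary.Unique.Propositional using (Unique)
open import Data.List.Relation.Unary.AllPairs using ([]; _∷_)
open import Data.Product using (Σ; ∃; _×_; _,_; proj₁; proj₂)
open import Data.Sum using (_⊎_; inj₁; inj₂)
import Data.Sum as Sum
open import Data.Empty using (⊥; ⊥-elim)
open import Function using (flip)
open import Function.Bundles using (Equivalence)
open import Relation.Nullary using (¬_; Dec; yes; no; contradiction)
open import Relation.Nullary.Decidable using (decidable-stable; ¬¬-excluded-middle)
open import Relation.Nullary.Negation using (¬¬-Monad; ¬¬-map)
open import Relation.Binary.PropositionalEquality using (_≡_; refl; sym; trans; subst; cong₂; module ≡-Reasoning)
import Relation.Binary.PropositionalEquality as Eq
open import Relation.Binary.Construct.Closure.ReflexiveTransitive using (ε; _◅_; _◅◅_; gmap)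
open import Induction.WellFounded using (WellFounded; Acc; acc; module Subrelation)
import Relation.Binary.Construct.On as On

∈-insert⁻ : {B : Set} {y b : B} (us : List B) {vs : List B} →
            y ∈ us ++ b ∷ vs → y ≡ b ⊎ y ∈ us ++ vs
∈-insert⁻ []       (here y≡b) = inj₁ y≡b
∈-insert⁻ []       (there m)  = inj₂ m
∈-insert⁻ (u ∷ us) (here y≡u) = inj₂ (here y≡u)
∈-insert⁻ (u ∷ us) (there m)  = Sum.map₂ there (∈-insert⁻ us m)

length-insert : {B : Set} {b : B} (us vs : List B) →
                length (us ++ b ∷ vs) ≡ suc (length (us ++ vs))
length-insert []       vs = refl
length-insert (u ∷ us) vs = Eq.cong suc (length-insert us vs)

functional-cover-length :
  {X B : Set} (R : B → X → Set) → (∀ {b x y} → R b x → R b y → x ≡ y) →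
  {xs : List X} {ys : List B} → Unique xs →
  All (λ x → ∃ λ b → b ∈ ys × R b x) xs → length xs ≤ length ys
functional-cover-length R functional {[]} _ _ = z≤n
functional-cover-length R functional {x ∷ xs} (x∉xs ∷ unique) ((b , b∈ys , Rbx) ∷ cover)
  with ∈-∃++ b∈ys
... | us , vs , refl =
  ≤-trans (s≤s (functional-cover-length R functional unique (All.zipWith avoid-b (x∉xs , cover))))
          (≤-reflexive (sym (length-insert us vs)))
  where
    -- b is the witness of x, so it witnesses no other element of xs
    avoid-b : ∀ {y} → (¬ x ≡ y) × (∃ λ b' → b' ∈ us ++ b ∷ vs × R b' y) →
              ∃ λ b' → b' ∈ us ++ vs × R b' y
    avoid-b (x≢y , b' , m , Rb'y) with ∈-insert⁻ us m
    ... | inj₁ refl = ⊥-elim (x≢y (functional Rbx Rb'y))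
    ... | inj₂ m'   = b' , m' , Rb'y

¬¬-normal-form : {T : Set} {_⟶_ : T → T → Set} {P : T → Set} →
  (∀ {a b} → a ⟶ b → P a → P b) →
  ∀ {a} → Acc (flip _⟶_) a → P a →
  ¬ ¬ (∃ λ b → (∀ c → ¬ b ⟶ c) × P b)
¬¬-normal-form preserves {a} (acc smaller) pa give-up = ¬¬-excluded-middle λ
  { (yes normal) → give-up (a , normal , pa)
  ; (no ¬normal) → ¬normal λ b a⟶b →
      ¬¬-normal-form preserves (smaller a⟶b) (preserves a⟶b pa) give-up }

Vec-ext : {X : Set} {n : ℕ} {xs ys : Vec X n} → (∀ i → lookup xs i ≡ lookup ys i) → xs ≡ ys
Vec-ext {xs = xs} {ys} same =
  trans (sym (tabulate∘lookup xs)) (trans (tabulate-cong same) (tabulate∘lookup ys))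

update-pointwise : {X : Set} (P : X → X → Set) → (∀ {x} → P x x) →
  {n : ℕ} (xs : Vec X n) (i : Fin n) {y : X} → P (lookup xs i) y →
  ∀ j → P (lookup xs j) (lookup (xs [ i ]≔ y) j)
update-pointwise P P-refl (x ∷ xs) zero    p zero    = p
update-pointwise P P-refl (x ∷ xs) zero    p (suc j) = P-refl
update-pointwise P P-refl (x ∷ xs) (suc i) p zero    = P-refl
update-pointwise P P-refl (x ∷ xs) (suc i) p (suc j) = update-pointwise P P-refl xs i p j

-- The i-th entry of a vector, with a default beyond its length; used to turn
-- the states q₁..qₙ into the state substitution xᵢ ↦ qᵢ.
stateAt : {m : ℕ} → Vec ℕ m → ℕ → ℕ
stateAt []       _       = 0
stateAt (q ∷ qs) 0       = q
stateAt (q ∷ qs) (suc x) = stateAt qs x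

stateAt-toℕ : {m : ℕ} (qs : Vec ℕ m) (i : Fin m) → stateAt qs (toℕ i) ≡ lookup qs i
stateAt-toℕ (q ∷ qs) zero    = refl
stateAt-toℕ (q ∷ qs) (suc i) = stateAt-toℕ qs i

module TreeAutomata (𝓕 : Signature) where
  open Signature 𝓕 using (arity)
  open Sig 𝓕

  lookup-substs : {V W : Set} {n : ℕ} (ts : Vec (Term V) n) (θ : V → Term W) (i : Fin n) →
                  lookup (substs ts θ) i ≡ lookup ts i ⟪ θ ⟫
  lookup-substs (t ∷ ts) θ zero    = refl
  lookup-substs (t ∷ ts) θ (suc i) = lookup-substs ts θ i

  mutual
    ⟪⟫-comp : {U V W : Set} (t : Term U) (θ : U → Term V) (ρ : V → Term W) →
              (t ⟪ θ ⟫) ⟪ ρ ⟫ ≡ t ⟪ (λ x → θ x ⟪ ρ ⟫) ⟫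
    ⟪⟫-comp (leaf x)    θ ρ = refl
    ⟪⟫-comp (node f ts) θ ρ = Eq.cong (node f) (substs-comp ts θ ρ)

    substs-comp : {U V W : Set} {n : ℕ} (ts : Vec (Term U) n) (θ : U → Term V) (ρ : V → Term W) →
                  substs (substs ts θ) ρ ≡ substs ts (λ x → θ x ⟪ ρ ⟫)
    substs-comp []       θ ρ = refl
    substs-comp (t ∷ ts) θ ρ = cong₂ _∷_ (⟪⟫-comp t θ ρ) (substs-comp ts θ ρ)

  mutual
    ⟪⟫-cong : {W : Set} {θ θ' : ℕ → Term W} (u : Term ℕ) →
              (∀ x → x ∈ leaves u → θ x ≡ θ' x) → u ⟪ θ ⟫ ≡ u ⟪ θ' ⟫
    ⟪⟫-cong (leaf x)    agree = agree x (here refl)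
    ⟪⟫-cong (node f us) agree = Eq.cong (node f) (substs-cong us agree)

    substs-cong : {W : Set} {θ θ' : ℕ → Term W} {n : ℕ} (us : Vec (Term ℕ) n) →
                  (∀ x → x ∈ leavesᵛ us → θ x ≡ θ' x) → substs us θ ≡ substs us θ'
    substs-cong []       agree = refl
    substs-cong (u ∷ us) agree =
      cong₂ _∷_ (⟪⟫-cong u (λ x m → agree x (∈-++⁺ˡ m)))
                (substs-cong us (λ x m → agree x (∈-++⁺ʳ (leaves u) m)))

  leaves-lookup : {n : ℕ} (us : Vec (Term ℕ) n) (i : Fin n) {x : ℕ} →
                  x ∈ leaves (lookup us i) → x ∈ leavesᵛ us
  leaves-lookup (u ∷ us) zero    m = ∈-++⁺ˡ m
  leaves-lookup (u ∷ us) (suc i) m = ∈-++⁺ʳ (leaves u) (leaves-lookup us i m)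

  leaves-subterm : {l r : Term ℕ} {p : Position} → SubtermAt l p r →
                   ∀ {x} → x ∈ leaves r → x ∈ leaves l
  leaves-subterm here              m = m
  leaves-subterm (there {ts = ts} i st) m = leaves-lookup ts i (leaves-subterm st m)

  SubtermAt-subst : {V W : Set} {t s : Term V} {p : Position} (θ : V → Term W) →
                    SubtermAt t p s → SubtermAt (t ⟪ θ ⟫) p (s ⟪ θ ⟫)
  SubtermAt-subst θ here = here
  SubtermAt-subst θ (there {ts = ts} {p} i st) =
    there i (subst (λ u → SubtermAt u p _) (sym (lookup-substs ts θ i)) (SubtermAt-subst θ st))

  mutual
    size : {V : Set} → Term V → ℕ
    size (leaf x)    = 0
    size (node f ts) = suc (sizes ts)

    sizes : {V : Set} {n : ℕ} → Vec (Term V) n → ℕ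
    sizes []       = 0
    sizes (t ∷ ts) = size t + sizes ts

  lookup-size≤ : {V : Set} {n : ℕ} (ts : Vec (Term V) n) (i : Fin n) → size (lookup ts i) ≤ sizes ts
  lookup-size≤ (t ∷ ts) zero    = m≤m+n _ _
  lookup-size≤ (t ∷ ts) (suc i) = ≤-trans (lookup-size≤ ts i) (m≤n+m _ _)

  update-sizes< : {V : Set} {n : ℕ} (ts : Vec (Term V) n) (i : Fin n) {t' : Term V} →
                  size t' < size (lookup ts i) → sizes (ts [ i ]≔ t') < sizes ts
  update-sizes< (t ∷ ts) zero    smaller = +-monoˡ-< (sizes ts) smaller
  update-sizes< (t ∷ ts) (suc i) smaller = +-monoʳ-< (size t) (update-sizes< ts i smaller)

  subterm-size≤ : {V : Set} {t s : Term V} {p : Position} → SubtermAt t p s → size s ≤ size t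
  subterm-size≤ here = ≤-refl
  subterm-size≤ (there {ts = ts} i st) =
    ≤-trans (subterm-size≤ st) (≤-trans (lookup-size≤ ts i) (n≤1+n _))

  proper-subterm-size< : {V : Set} {t s : Term V} {p : Position} →
                         ¬ p ≡ [] → SubtermAt t p s → size s < size t
  proper-subterm-size< p≢λ here = contradiction refl p≢λ
  proper-subterm-size< p≢λ (there {ts = ts} i st) =
    s≤s (≤-trans (subterm-size≤ st) (lookup-size≤ ts i))

  ProperSubtermRules : EqSet → Set
  ProperSubtermRules R = ∀ l r → R (l , r) → Σ Position λ p → ¬ p ≡ [] × SubtermAt l p r

  rewriting-size< : {R : EqSet} → ProperSubtermRules R →
                    ∀ {t t'} → RStep R t t' → size t' < size t
  rewriting-size< proper (root {l} {r} rule θ) with proper l r rule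
  ... | p , p≢λ , l|p≡r = proper-subterm-size< p≢λ (SubtermAt-subst θ l|p≡r)
  rewriting-size< proper (cong {ts = ts} i step) =
    s≤s (update-sizes< ts i (rewriting-size< proper step))

  rewriting-terminates : {R : EqSet} → ProperSubtermRules R → WellFounded (flip (RStep R))
  rewriting-terminates proper =
    Subrelation.wellFounded (rewriting-size< proper) (On.wellFounded size <-wellFounded)

  data Run (A : Automaton) : Term ℕ → State → Set where
    leafR : ∀ {q} → Run A (leaf q) q
    nodeR : ∀ {f ts qs q} → (∀ i → Run A (lookup ts i) (lookup qs i)) →
            norm f qs q ∈ delta A → Run A (node f ts) q

  module _ {A : Automaton} where

    Run-args : ∀ {f} {ts us : Vec (Term ℕ) (arity f)} {q} →
               (∀ j {p} → Run A (lookup ts j) p → Run A (lookup us j) p) →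
               Run A (node f ts) q → Run A (node f us) q
    Run-args transfer (nodeR runs m) = nodeR (λ j → transfer j (runs j)) m

    RunsBackwards : Term ℕ → Term ℕ → Set
    RunsBackwards s t = ∀ {p} → Run A t p → Run A s p

    Run-step⁻¹ : ∀ {s t q} → Step A s t → Run A t q → Run A s q
    Run-step⁻¹ (root {qs = qs} m) leafR =
      nodeR (λ i → subst (λ s → Run A s (lookup qs i)) (sym (lookup-map i leaf qs)) leafR) m
    Run-step⁻¹ (cong {ts = ts} i step) run =
      Run-args (update-pointwise RunsBackwards (λ r → r) ts i (Run-step⁻¹ step)) run

    →*⇒Run : ∀ {s q} → A ⊢ s →* leaf q → Run A s q
    →*⇒Run ε             = leafR
    →*⇒Run (step ◅ steps) = Run-step⁻¹ step (→*⇒Run steps)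

    →*-pointwise : {n : ℕ} (C : Vec (Term ℕ) n → Term ℕ) →
      (∀ ts i {t'} → Step A (lookup ts i) t' → Step A (C ts) (C (ts [ i ]≔ t'))) →
      ∀ {ts us} → (∀ i → A ⊢ lookup ts i →* lookup us i) → A ⊢ C ts →* C us
    →*-pointwise C C-step {[]}     {[]}     steps = ε
    →*-pointwise C C-step {t ∷ ts} {u ∷ us} steps =
      gmap (λ a → C (a ∷ ts)) (C-step (_ ∷ ts) zero) (steps zero)
      ◅◅ →*-pointwise (λ vs → C (u ∷ vs)) (λ vs i → C-step (u ∷ vs) (suc i)) (λ i → steps (suc i))

    Run⇒→* : ∀ {s q} → Run A s q → A ⊢ s →* leaf q
    Run⇒→* leafR = ε
    Run⇒→* (nodeR {f} {ts} {qs} runs m) =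
      →*-pointwise (node f) (λ ts i → cong i)
        (λ i → subst (λ u → A ⊢ lookup ts i →* u) (sym (lookup-map i leaf qs)) (Run⇒→* (runs i)))
      ◅◅ root m ◅ ε

    Run-subterm : ∀ {t s p q} → SubtermAt t p s → Run A t q → ∃ λ q' → Run A s q'
    Run-subterm here run = _ , run
    Run-subterm (there i st) (nodeR runs m) = Run-subterm st (runs i)

    mutual
      Run-compose : ∀ {q} (u : Term ℕ) (σ : ℕ → State) (θ : ℕ → Term ℕ) →
        Run A (u ⟨ σ ⟩) q → (∀ x → x ∈ leaves u → Run A (θ x) (σ x)) → Run A (u ⟪ θ ⟫) q
      Run-compose (leaf x)    σ θ leafR                     args = args x (here refl)
      Run-compose (node f us) σ θ (nodeR {qs = qs} runs m) args =
        nodeR (Runs-compose us {qs} σ θ runs args) m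

      Runs-compose : ∀ {n} (us : Vec (Term ℕ) n) {qs : Vec State n} (σ : ℕ → State) (θ : ℕ → Term ℕ) →
        (∀ i → Run A (lookup (substs us (λ x → leaf (σ x))) i) (lookup qs i)) →
        (∀ x → x ∈ leavesᵛ us → Run A (θ x) (σ x)) →
        ∀ i → Run A (lookup (substs us θ) i) (lookup qs i)
      Runs-compose (u ∷ us) σ θ runs args zero =
        Run-compose u σ θ (runs zero) (λ x m → args x (∈-++⁺ˡ m))
      Runs-compose (u ∷ us) {q ∷ qs} σ θ runs args (suc i) =
        Runs-compose us {qs} σ θ (λ j → runs (suc j)) (λ x m → args x (∈-++⁺ʳ (leaves u) m)) i

  Run-functional : ∀ {A s q q'} → Deterministic A → Run A s q → Run A s q' → q ≡ q'
  Run-functional det leafR leafR = refl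
  Run-functional {A} {q' = q'} det (nodeR {f} {qs = qs} runs m) (nodeR runs' m') =
    det m (subst (λ qs' → norm f qs' q' ∈ delta A)
                 (sym (Vec-ext (λ i → Run-functional det (runs i) (runs' i)))) m')

  merge : List ℕ → (ℕ → State) → (ℕ → State) → ℕ → State
  merge xs σ₁ σ₂ x with x ∈? xs
  ... | yes _ = σ₁ x
  ... | no  _ = σ₂ x

  merge-inside : ∀ {xs σ₁ σ₂ x} → x ∈ xs → merge xs σ₁ σ₂ x ≡ σ₁ x
  merge-inside {xs} {x = x} m with x ∈? xs
  ... | yes _  = refl
  ... | no x∉ = contradiction m x∉

  merge-outside : ∀ {xs σ₁ σ₂ x} → x ∉ xs → merge xs σ₁ σ₂ x ≡ σ₂ x
  merge-outside {xs} {x = x} x∉ with x ∈? xs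
  ... | yes m = contradiction m x∉
  ... | no  _ = refl

  module Decompose {A : Automaton} (det : Deterministic A) where

    Decomposition : Term ℕ → (ℕ → Term ℕ) → State → Set
    Decomposition u θ q = Σ (ℕ → State) λ σ →
      Run A (u ⟨ σ ⟩) q × (∀ x → x ∈ leaves u → Run A (θ x) (σ x))

    Decompositions : {n : ℕ} → Vec (Term ℕ) n → (ℕ → Term ℕ) → Vec State n → Set
    Decompositions us θ qs = Σ (ℕ → State) λ σ →
      (∀ i → Run A (lookup (substs us (λ x → leaf (σ x))) i) (lookup qs i)) ×
      (∀ x → x ∈ leavesᵛ us → Run A (θ x) (σ x))

    mutual
      Run-decompose : ∀ {q} (u : Term ℕ) (θ : ℕ → Term ℕ) → Run A (u ⟪ θ ⟫) q → Decomposition u θ q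
      Run-decompose {q} (leaf x) θ run = (λ _ → q) , leafR , λ { _ (here refl) → run }
      Run-decompose (node f us) θ (nodeR {qs = qs} runs m) with Runs-decompose us {qs} θ runs
      ... | σ , runs' , args = σ , nodeR runs' m , args

      Runs-decompose : ∀ {n} (us : Vec (Term ℕ) n) {qs : Vec State n} (θ : ℕ → Term ℕ) →
        (∀ i → Run A (lookup (substs us θ) i) (lookup qs i)) → Decompositions us θ qs
      Runs-decompose [] θ runs = (λ _ → 0) , (λ ()) , (λ _ ())
      Runs-decompose (u ∷ us) {q ∷ qs} θ runs
        with Run-decompose u θ (runs zero) | Runs-decompose us {qs} θ (λ i → runs (suc i))
      ... | σ₁ , run₁ , args₁ | σ₂ , runs₂ , args₂ = σ , merged-runs , merged-args
        where
          σ : ℕ → State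
          σ = merge (leaves u) σ₁ σ₂

          σ₂-agrees : ∀ x → x ∈ leavesᵛ us → σ₂ x ≡ σ x
          σ₂-agrees x m = by-cases (x ∈? leaves u)
            where
              by-cases : Dec (x ∈ leaves u) → σ₂ x ≡ σ x
              by-cases (yes m₁) = trans (Run-functional det (args₂ x m) (args₁ x m₁)) (sym (merge-inside m₁))
              by-cases (no  m₁) = sym (merge-outside m₁)

          merged-runs : ∀ i → Run A (lookup (substs (u ∷ us) (λ x → leaf (σ x))) i) (lookup (q ∷ qs) i)
          merged-runs zero = subst (λ t → Run A t _)
            (⟪⟫-cong u (λ x m → Eq.cong leaf (sym (merge-inside m)))) run₁
          merged-runs (suc i) = subst (λ t → Run A t _)
            (trans (lookup-substs us (λ x → leaf (σ₂ x)) i)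
              (trans (⟪⟫-cong (lookup us i) (λ x m → Eq.cong leaf (σ₂-agrees x (leaves-lookup us i m))))
                     (sym (lookup-substs us (λ x → leaf (σ x)) i))))
            (runs₂ i)

          merged-args : ∀ x → x ∈ leaves u ++ leavesᵛ us → Run A (θ x) (σ x)
          merged-args x m with ∈-++⁻ (leaves u) m
          ... | inj₁ m₁ = subst (Run A _) (sym (merge-inside m₁)) (args₁ x m₁)
          ... | inj₂ m₂ = subst (Run A _) (σ₂-agrees x m₂) (args₂ x m₂)

  reflTerm-instance : (f : Symbol) (qs : Vec State (arity f)) →
                      reflTerm f ⟨ stateAt qs ⟩ ≡ node f (Vec.map leaf qs)
  reflTerm-instance f qs = Eq.cong (node f) (Vec-ext entry)
    where
      open ≡-Reasoning
      entry : ∀ i → lookup (substs (tabulate (λ i → leaf (toℕ i))) (λ x → leaf (stateAt qs x))) i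
                    ≡ lookup (Vec.map leaf qs) i
      entry i = begin
        lookup (substs (tabulate (λ i → leaf (toℕ i))) _) i ≡⟨ lookup-substs (tabulate (λ i → leaf (toℕ i))) _ i ⟩
        lookup (tabulate (λ i → leaf (toℕ i))) i ⟨ stateAt qs ⟩
          ≡⟨ Eq.cong (_⟨ stateAt qs ⟩) (lookup∘tabulate (λ i → leaf (toℕ i)) i) ⟩
        leaf (stateAt qs (toℕ i))                          ≡⟨ Eq.cong leaf (stateAt-toℕ qs i) ⟩
        leaf (lookup qs i)                                 ≡⟨ sym (lookup-map i leaf qs) ⟩
        lookup (Vec.map leaf qs) i                         ∎

  module Irreducible {Ec E : EqSet} (contracting : Contracting Ec) (E⊇ : E ⊇ Ec ∪ Eʳ)
                     {A : Automaton} (irreducible : Irreducible E A) where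

    -- Both sides of an instance of an equation of E reach the same state,
    -- since otherwise the equation would merge the two states.
    same-state : ∀ {s t σ qa qb} → E (s , t) →
                 A ⊢ s ⟨ σ ⟩ →* leaf qa → A ⊢ t ⟨ σ ⟩ →* leaf qb → qa ≡ qb
    same-state {s} {t} {σ} {qa} {qb} e s→qa t→qb = decidable-stable (qa ≟ qb) λ qa≢qb →
      irreducible _ (s , t , e , σ , qa , qb , qa≢qb , s→qa , t→qb , refl)

    -- Determinism, by the reflexivity equations.
    deterministic : Deterministic A
    deterministic {f} {qs} {q} {q'} m m' =
      same-state (E⊇ _ (inj₂ (reflEq f))) (refl-run m) (refl-run m')
      where
        refl-run : ∀ {p} → norm f qs p ∈ delta A → A ⊢ reflTerm f ⟨ stateAt qs ⟩ →* leaf p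
        refl-run {p} m = subst (λ s → A ⊢ s →* leaf p) (sym (reflTerm-instance f qs)) (root m ◅ ε)

    open Decompose {A} deterministic

    proper : ProperSubtermRules Ec
    proper l r rule = proj₂ (proj₁ contracting l r rule)

    contraction-preserves : ∀ {l r q} → Ec (l , r) → (θ : ℕ → Term ℕ) →
                            Run A (l ⟪ θ ⟫) q → Run A (r ⟪ θ ⟫) q
    contraction-preserves {l} {r} rule θ run with Run-decompose l θ run | proper l r rule
    ... | σ , lσ→q , args | _ , _ , l|p≡r with Run-subterm (SubtermAt-subst _ l|p≡r) lσ→q
    ... | q' , rσ→q' with same-state (E⊇ _ (inj₁ rule)) (Run⇒→* lσ→q) (Run⇒→* rσ→q')
    ... | refl = Run-compose r σ θ rσ→q' (λ x m → args x (leaves-subterm l|p≡r m))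

    rewriting-preserves : ∀ {t t' q} → RStep Ec t t' → Run A (ground t) q → Run A (ground t') q
    rewriting-preserves {q = q} (root {l} {r} rule θ) run =
      subst (λ t → Run A t q) (sym (⟪⟫-comp r θ ⊥-elim))
        (contraction-preserves rule _ (subst (λ t → Run A t q) (⟪⟫-comp l θ ⊥-elim) run))
    rewriting-preserves (cong {ts = ts} {t'} i step) =
      Run-args λ j {p} run → subst (λ t → Run A t p) (sym (lookup-substs (ts [ i ]≔ t') ⊥-elim j))
        (update-pointwise GroundTransfer (λ r → r) ts i (rewriting-preserves step) j
          (subst (λ t → Run A t p) (lookup-substs ts ⊥-elim j) run))
      where
        GroundTransfer : Term ⊥ → Term ⊥ → Set
        GroundTransfer s t = ∀ {p} → Run A (ground s) p → Run A (ground t) p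

    reached-by-normal-form : ∀ {t q} → Run A (ground t) q →
                             ¬ ¬ (∃ λ t₀ → Irr Ec t₀ × Run A (ground t₀) q)
    reached-by-normal-form {t} =
      ¬¬-normal-form rewriting-preserves (rewriting-terminates proper t)

    -- Distinct states need distinct normal forms to reach them.
    states-bounded : ∀ {ts qs} → EnumeratesIrr Ec ts → Unique qs →
                     All (IsStateOf A) qs → length qs ≤ length ts
    states-bounded {ts} {qs} (_ , enumerates) unique states =
      decidable-stable (length qs ≤? length ts)
        (¬¬-map (functional-cover-length (λ t q → Run A (ground t) q)
                                         (Run-functional deterministic) unique)
                (All.sequenceM 0ℓ ¬¬-Monad (All.map listed-witness states)))
      where
        listed-witness : ∀ {q} → IsStateOf A q →
                         ¬ ¬ (∃ λ t₀ → t₀ ∈ ts × Run A (ground t₀) q)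
        listed-witness (t , t→q) =
          ¬¬-map (λ { (t₀ , normal , run) → t₀ , Equivalence.to (enumerates t₀) normal , run })
                 (reached-by-normal-form {t} (→*⇒Run t→q))

lemma2 : (𝓕 : Signature) → let open Sig 𝓕 in
    (A : Automaton) (Ec E : EqSet) →
    Contracting Ec →
    E ⊇ Ec ∪ Eʳ →
    (A' : Automaton) → SimpNF E A A' →
    Deterministic A'
    × (∀ (ts : List (Term ⊥)) → EnumeratesIrr Ec ts →
    ∀ (qs : List State) → Unique qs → All (IsStateOf A') qs →
    length qs ≤ length ts)
lemma2 𝓕 A Ec E contracting E⊇ A' (_ , irreducible) =
  deterministic , λ ts enumerates qs unique states → states-bounded enumerates unique states
  where
    open TreeAutomata 𝓕
    open Irreducible contracting E⊇ irreducible
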